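{- Let $G$ be a connected bipartite graph of order $n=r+s\ge 4$ with stable sets $U$ and $W$, $|U|=r\le s=|W|$, and let $S$ be a locating-dominating set of $G$ of minimum cardinality $\lambda(G)$. Then $\lambda(\overline{G})\le\lambda(G)$ if any of the following conditions holds: (i) $S\cap U\neq\emptyset$ and $S\cap W\neq\emptyset$; (ii) $r<s$ and $S=W$; (iii) $2^r\le s$.
   Context: A set $S$ of vertices is distinguishing if $N(x)\cap S\neq N(y)\cap S$ for all distinct vertices $x,y\notin S$ ($N$ = open neighborhood); a locating-dominating set is a distinguishing set $S$ such that every vertex not in $S$ has a neighbor in $S$. $\lambda(G)$ is the minimum cardinality of a locating-dominating set of $G$, and $\overline{G}$ is the complement of $G$. -}

module Defs where

open import Data.Nat using (ℕ; _≤_; _<_; _^_)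
open import Data.Fin using (Fin; _≟_)
open import Data.Fin.Subset using (Subset; _∈_; _∉_; ∣_∣)
open import Data.Bool using (Bool; true; false; not; if_then_else_)
open import Data.Product using (Σ; ∃; _×_)
open import Relation.Nullary using (¬_)
open import Relation.Nullary.Decidable using (⌊_⌋)
open import Relation.Binary.PropositionalEquality using (_≡_; _≢_)

Adj : ℕ → Set
Adj n = Fin n → Fin n → Bool

IsSimple : ∀ {n} → Adj n → Set
IsSimple {n} G = (∀ (x y : Fin n) → G x y ≡ G y x) × (∀ (x : Fin n) → G x x ≡ false)

complement : ∀ {n} → Adj n → Adj n
complement G x y = if ⌊ x ≟ y ⌋ then false else not (G x y)

data Reach {n} (G : Adj n) : Fin n → Fin n → Set where
  here : ∀ {x} → Reach G x x
  step : ∀ {x y z} → G x y ≡ true → Reach G y z → Reach G x z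

Connected : ∀ {n} → Adj n → Set
Connected {n} G = ∀ (x y : Fin n) → Reach G x y

Stable : ∀ {n} → Adj n → Subset n → Set
Stable {n} G A = ∀ (x y : Fin n) → x ∈ A → y ∈ A → G x y ≡ false

Distinguishing : ∀ {n} → Adj n → Subset n → Set
Distinguishing {n} G S =
  ∀ (x y : Fin n) → x ∉ S → y ∉ S → x ≢ y →
    ¬ (∀ (z : Fin n) → z ∈ S → G x z ≡ G y z)

Dominating : ∀ {n} → Adj n → Subset n → Set
Dominating {n} G S = ∀ (x : Fin n) → x ∉ S → ∃ λ z → z ∈ S × G x z ≡ true

IsLD : ∀ {n} → Adj n → Subset n → Set
IsLD G S = Distinguishing G S × Dominating G S

IsMinLD : ∀ {n} → Adj n → Subset n → Set
IsMinLD {n} G S = IsLD G S × (∀ (T : Subset n) → IsLD G T → ∣ S ∣ ≤ ∣ T ∣)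

-- λ(G) ≤ k  (λ(G) is the minimum size of an LD set; V is always LD, so the minimum exists).
LambdaAtMost : ∀ {n} → Adj n → ℕ → Set
LambdaAtMost {n} G k = ∃ λ (T : Subset n) → IsLD G T × ∣ T ∣ ≤ k

-- Two vertices on the same side of a bipartite graph are adjacent in the complement, and for
-- distinct x, z the complement flips the edge xz, so a set that distinguishes in G distinguishes
-- in the complement.  Hence S stays locating-dominating in the complement once every vertex
-- outside S has a non-neighbour in S, which is case (i).  In case (ii) either W already works,
-- or some u ∈ U is adjacent to all of W; then by Bondy's theorem the |U| < |W| traces of U on W
-- stay distinct on W - w for a suitable w, and (W - w) ∪ {u} works in the complement.  In case
-- (iii), S ⊆ W forces S = W (case (ii)), while S ⊆ U is impossible since a locating-dominating
-- set S leaves fewer than 2^|S| vertices outside.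
module Submission where

open import Defs
open import Data.Nat using (ℕ; zero; suc; _≤_; _<_; _^_; _+_; z≤n; s≤s)
open import Data.Nat.Properties
  using (≤-trans; ≤-refl; ≤-reflexive; <-≤-trans; ≤-<-trans; +-mono-≤; +-monoʳ-≤; +-suc;
         +-identityʳ; m^n>0; ^-monoʳ-≤; <-irrefl; <⇒≱; module ≤-Reasoning)
open import Data.Fin using (Fin; zero; suc; _≟_)
open import Data.Fin.Properties using (suc-injective; any?; all?; ¬∀⟶∃¬)
open import Data.Fin.Subset
  using (Subset; inside; outside; _∈_; _∉_; _⊆_; ∣_∣; ∁; _∩_; _∪_; _-_; ⁅_⁆; Nonempty; Empty)
open import Data.Fin.Subset.Properties
  using (_∈?_; nonempty?; x∈p∩q⁺; x∈p∩q⁻; x∈p∪q⁺; x∈p∧x≢y⇒x∈p-y; p─q⊆p; x∈p⇒∣p-x∣<∣p∣;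
         x∈⁅x⁆; ∣⁅x⁆∣≡1; ∣p∣≤∣x∷p∣; Empty-unique; ∣⊥∣≡0; p⊆q⇒∣p∣≤∣q∣; ⊆-antisym;
         x∈∁p⇒x∉p; x∉∁p⇒x∈p; x∉p⇒x∈∁p; x∈p⇒x∉∁p)
open import Data.Bool using (Bool; true; false; not)
open import Data.Bool.Properties using (not-injective; ¬-not) renaming (_≟_ to _≟ᵇ_)
open import Data.Vec using ([]; _∷_; tabulate; here; there)
open import Data.Vec.Properties using (lookup∘tabulate; []=⇒lookup; lookup⇒[]=)
open import Data.Vec.Functional using (head; tail)
open import Data.Product using (_×_; _,_; proj₁; proj₂; ∃)
open import Data.Sum using (_⊎_; inj₁; inj₂)
open import Data.Empty using (⊥-elim)
open import Function using (_∘_)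
open import Relation.Nullary using (¬_; Dec; yes; no; ¬?)
open import Relation.Nullary.Decidable using (_×-dec_; _→-dec_; decidable-stable)
open import Relation.Binary.PropositionalEquality
  using (_≡_; _≢_; refl; sym; trans; cong; subst; module ≡-Reasoning)

AgreeOn : ∀ {n} → Subset n → (Fin n → Bool) → (Fin n → Bool) → Set
AgreeOn C u v = ∀ j → j ∈ C → u j ≡ v j

module _ {n : ℕ} {C : Subset n} where

  agree-sym : ∀ {u v} → AgreeOn C u v → AgreeOn C v u
  agree-sym uv j j∈C = sym (uv j j∈C)

  agree-trans : ∀ {u v w} → AgreeOn C u v → AgreeOn C v w → AgreeOn C u w
  agree-trans uv vw j j∈C = trans (uv j j∈C) (vw j j∈C)

  agree-mono : ∀ {D u v} → D ⊆ C → AgreeOn C u v → AgreeOn D u v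
  agree-mono D⊆C uv j j∈D = uv j (D⊆C j∈D)

  agree-off : ∀ {i j u v} → AgreeOn (C - i) u v → j ∈ C → j ≢ i → u j ≡ v j
  agree-off uv j∈C j≢i = uv _ (x∈p∧x≢y⇒x∈p-y j∈C j≢i)

  agree? : ∀ u v → Dec (AgreeOn C u v)
  agree? u v = all? (λ j → j ∈? C →-dec u j ≟ᵇ v j)

module _ {n : ℕ} {C : Subset n} {u v : Fin (suc n) → Bool} where

  agree-tail : ∀ {s} → AgreeOn (s ∷ C) u v → AgreeOn C (tail u) (tail v)
  agree-tail uv j j∈C = uv (suc j) (there j∈C)

  agree-outside : AgreeOn C (tail u) (tail v) → AgreeOn (outside ∷ C) u v
  agree-outside uv (suc j) (there j∈C) = uv j j∈C

  agree-inside : head u ≡ head v → AgreeOn C (tail u) (tail v) → AgreeOn (inside ∷ C) u v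
  agree-inside u₀≡v₀ uv zero    here          = u₀≡v₀
  agree-inside u₀≡v₀ uv (suc j) (there j∈C) = uv j j∈C

Separates : ∀ {m n} → (Fin m → Fin n → Bool) → Subset n → Subset m → Set
Separates f C W = ∀ {a b} → a ∈ W → b ∈ W → AgreeOn C (f a) (f b) → a ≡ b

∣p∣≤1 : ∀ {m} (p : Subset m) → (∀ {a b} → a ∈ p → b ∈ p → a ≡ b) → ∣ p ∣ ≤ 1
∣p∣≤1 []            _      = z≤n
∣p∣≤1 (outside ∷ p) unique =
  ∣p∣≤1 p (λ a∈p b∈p → suc-injective (unique (there a∈p) (there b∈p)))
∣p∣≤1 {suc m} (inside ∷ p) unique =
  s≤s (≤-reflexive (trans (cong ∣_∣ (Empty-unique p-empty)) (∣⊥∣≡0 m)))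
  where
  p-empty : Empty p
  p-empty (a , a∈p) with unique here (there a∈p)
  ... | ()

∣p∩q∣+∣p∩∁q∣≡∣p∣ : ∀ {m} (p q : Subset m) → ∣ p ∩ q ∣ + ∣ p ∩ ∁ q ∣ ≡ ∣ p ∣
∣p∩q∣+∣p∩∁q∣≡∣p∣ []            []            = refl
∣p∩q∣+∣p∩∁q∣≡∣p∣ (outside ∷ p) (_ ∷ q)       = ∣p∩q∣+∣p∩∁q∣≡∣p∣ p q
∣p∩q∣+∣p∩∁q∣≡∣p∣ (inside ∷ p)  (inside ∷ q)  = cong suc (∣p∩q∣+∣p∩∁q∣≡∣p∣ p q)
∣p∩q∣+∣p∩∁q∣≡∣p∣ (inside ∷ p)  (outside ∷ q) =
  trans (+-suc ∣ p ∩ q ∣ ∣ p ∩ ∁ q ∣) (cong suc (∣p∩q∣+∣p∩∁q∣≡∣p∣ p q))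

∣p∪q∣≤∣p∣+∣q∣ : ∀ {m} (p q : Subset m) → ∣ p ∪ q ∣ ≤ ∣ p ∣ + ∣ q ∣
∣p∪q∣≤∣p∣+∣q∣ []            []            = z≤n
∣p∪q∣≤∣p∣+∣q∣ (outside ∷ p) (outside ∷ q) = ∣p∪q∣≤∣p∣+∣q∣ p q
∣p∪q∣≤∣p∣+∣q∣ (outside ∷ p) (inside ∷ q)  =
  ≤-trans (s≤s (∣p∪q∣≤∣p∣+∣q∣ p q)) (≤-reflexive (sym (+-suc ∣ p ∣ ∣ q ∣)))
∣p∪q∣≤∣p∣+∣q∣ (inside ∷ p)  (s ∷ q)       =
  s≤s (≤-trans (∣p∪q∣≤∣p∣+∣q∣ p q) (+-monoʳ-≤ ∣ p ∣ (∣p∣≤∣x∷p∣ s q)))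

∣p∣≤1+∣p-x∣ : ∀ {m} (p : Subset m) x → ∣ p ∣ ≤ suc ∣ p - x ∣
∣p∣≤1+∣p-x∣ p x = begin
  ∣ p ∣                 ≤⟨ p⊆q⇒∣p∣≤∣q∣ p⊆⁅x⁆∪p-x ⟩
  ∣ ⁅ x ⁆ ∪ (p - x) ∣   ≤⟨ ∣p∪q∣≤∣p∣+∣q∣ ⁅ x ⁆ (p - x) ⟩
  ∣ ⁅ x ⁆ ∣ + ∣ p - x ∣ ≡⟨ cong (_+ ∣ p - x ∣) (∣⁅x⁆∣≡1 x) ⟩
  suc ∣ p - x ∣         ∎
  where
  open ≤-Reasoning
  p⊆⁅x⁆∪p-x : p ⊆ ⁅ x ⁆ ∪ (p - x)
  p⊆⁅x⁆∪p-x {y} y∈p with y ≟ x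
  ... | yes refl = x∈p∪q⁺ (inj₁ (x∈⁅x⁆ x))
  ... | no  y≢x  = x∈p∪q⁺ (inj₂ (x∈p∧x≢y⇒x∈p-y y∈p y≢x))

∉∈⇒≢ : ∀ {m} {p : Subset m} {x z} → x ∉ p → z ∈ p → x ≢ z
∉∈⇒≢ x∉p z∈p refl = x∉p z∈p

disjoint⇒⊆∁ : ∀ {m} {p q : Subset m} → Empty (p ∩ q) → p ⊆ ∁ q
disjoint⇒⊆∁ p∩q=∅ x∈p = x∉p⇒x∈∁p (λ x∈q → p∩q=∅ (_ , x∈p∩q⁺ (x∈p , x∈q)))

0<∣p∣ : ∀ {m} {p : Subset m} {x} → x ∈ p → 0 < ∣ p ∣
0<∣p∣ x∈p = ≤-<-trans z≤n (x∈p⇒∣p-x∣<∣p∣ x∈p)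

∈-tabulate⁻ : ∀ {m} {g : Fin m → Bool} {a} → a ∈ tabulate g → g a ≡ true
∈-tabulate⁻ {g = g} {a} a∈ = trans (sym (lookup∘tabulate g a)) ([]=⇒lookup a∈)

∉-tabulate⁻ : ∀ {m} {g : Fin m → Bool} {a} → a ∉ tabulate g → g a ≡ false
∉-tabulate⁻ {g = g} {a} a∉ with g a ≟ᵇ true
... | yes ga≡true = ⊥-elim (a∉ (lookup⇒[]= a _ (trans (lookup∘tabulate g a) ga≡true)))
... | no  ga≢true = ¬-not ga≢true

n<2^n : ∀ n → n < 2 ^ n
n<2^n zero    = s≤s z≤n
n<2^n (suc n) = ≤-trans (+-mono-≤ (m^n>0 2 n) (n<2^n n))
                        (+-monoʳ-≤ (2 ^ n) (≤-reflexive (sym (+-identityʳ (2 ^ n)))))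

separated⇒∣W∣≤2^∣C∣ : ∀ {m n} (f : Fin m → Fin n → Bool) (C : Subset n) (W : Subset m) →
                 Separates f C W → ∣ W ∣ ≤ 2 ^ ∣ C ∣
separated⇒∣W∣≤2^∣C∣ f []            W sep = ∣p∣≤1 W (λ a∈W b∈W → sep a∈W b∈W (λ _ ()))
separated⇒∣W∣≤2^∣C∣ f (outside ∷ C) W sep =
  separated⇒∣W∣≤2^∣C∣ (tail ∘ f) C W (λ a∈W b∈W → sep a∈W b∈W ∘ agree-outside)
separated⇒∣W∣≤2^∣C∣ f (inside ∷ C)  W sep = begin
  ∣ W ∣                             ≡⟨ sym (∣p∩q∣+∣p∩∁q∣≡∣p∣ W H) ⟩
  ∣ W ∩ H ∣ + ∣ W ∩ ∁ H ∣           ≤⟨ +-mono-≤ (separated⇒∣W∣≤2^∣C∣ (tail ∘ f) C (W ∩ H) sep-H)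
                                                (separated⇒∣W∣≤2^∣C∣ (tail ∘ f) C (W ∩ ∁ H) sep-∁H) ⟩
  2 ^ ∣ C ∣ + 2 ^ ∣ C ∣             ≡⟨ cong (2 ^ ∣ C ∣ +_) (sym (+-identityʳ (2 ^ ∣ C ∣))) ⟩
  2 ^ ∣ inside ∷ C ∣                ∎
  where
  open ≤-Reasoning
  H : Subset _
  H = tabulate (head ∘ f)

  sep-tail : ∀ {X} → X ⊆ W → (∀ {a b} → a ∈ X → b ∈ X → head (f a) ≡ head (f b)) →
             Separates (tail ∘ f) C X
  sep-tail X⊆W same-head a∈X b∈X = sep (X⊆W a∈X) (X⊆W b∈X) ∘ agree-inside (same-head a∈X b∈X)

  sep-H : Separates (tail ∘ f) C (W ∩ H)
  sep-H = sep-tail (proj₁ ∘ x∈p∩q⁻ W H) λ a∈ b∈ →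
    trans (∈-tabulate⁻ (proj₂ (x∈p∩q⁻ W H a∈))) (sym (∈-tabulate⁻ (proj₂ (x∈p∩q⁻ W H b∈))))

  sep-∁H : Separates (tail ∘ f) C (W ∩ ∁ H)
  sep-∁H = sep-tail (proj₁ ∘ x∈p∩q⁻ W (∁ H)) λ a∈ b∈ →
    trans (∉-tabulate⁻ (x∈∁p⇒x∉p (proj₂ (x∈p∩q⁻ W (∁ H) a∈))))
          (sym (∉-tabulate⁻ (x∈∁p⇒x∉p (proj₂ (x∈p∩q⁻ W (∁ H) b∈)))))

separated-nonzero⇒∣W∣<2^∣C∣ : ∀ {m n} (f : Fin m → Fin n → Bool) (C : Subset n) (W : Subset m) →
                         Separates f C W → (∀ {a} → a ∈ W → ∃ λ j → j ∈ C × f a j ≡ true) →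
                         ∣ W ∣ < 2 ^ ∣ C ∣
separated-nonzero⇒∣W∣<2^∣C∣ {m} {n} f C W sep nonzero = separated⇒∣W∣≤2^∣C∣ f₀ C (inside ∷ W) sep₀
  where
  f₀ : Fin (suc m) → Fin n → Bool
  f₀ zero    _ = false
  f₀ (suc a) = f a

  not-zero-row : ∀ {a} → a ∈ W → ¬ AgreeOn C (f a) (f₀ zero)
  not-zero-row a∈W fa≡0 with nonzero a∈W
  ... | j , j∈C , faj≡true with trans (sym faj≡true) (fa≡0 j j∈C)
  ... | ()

  sep₀ : Separates f₀ C (inside ∷ W)
  sep₀ here        here        _   = refl
  sep₀ here        (there b∈W) agr = ⊥-elim (not-zero-row b∈W (agree-sym agr))
  sep₀ (there a∈W) here        agr = ⊥-elim (not-zero-row a∈W agr)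
  sep₀ (there a∈W) (there b∈W) agr = cong suc (sep a∈W b∈W agr)

-- A collision is a pair of rows of R agreeing on the later coordinates of C but not on the first.
-- With no collision the first coordinate is redundant; otherwise delete one row of a colliding
-- pair and recurse, its partner representing it on the later coordinates.
redundant-coordinate :
  ∀ {m n} (f : Fin m → Fin n → Bool) (R : Subset m) (C : Subset n) → ∣ R ∣ < ∣ C ∣ →
  ∃ λ i → i ∈ C × (∀ {a b} → a ∈ R → b ∈ R → AgreeOn (C - i) (f a) (f b) → AgreeOn C (f a) (f b))
redundant-coordinate f R []            ()
redundant-coordinate f R (outside ∷ C) ∣R∣<∣C∣
  with redundant-coordinate (tail ∘ f) R C ∣R∣<∣C∣
... | i , i∈C , redundant =
  suc i , there i∈C , λ a∈R b∈R → agree-outside ∘ redundant a∈R b∈R ∘ agree-tail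
redundant-coordinate f R (inside ∷ C)  (s≤s ∣R∣≤∣C∣)
  with any? (λ r₁ → any? (λ r₂ → ((r₁ ∈? R ×-dec r₂ ∈? R)
                                   ×-dec agree? (tail (f r₁)) (tail (f r₂)))
                                   ×-dec ¬? (head (f r₁) ≟ᵇ head (f r₂))))
... | no no-collision = zero , here , λ {a} {b} a∈R b∈R agr →
  let tails = λ j j∈C → agree-off {C = inside ∷ C} {i = zero} agr (there j∈C) (λ ())
      heads = λ head≢ → no-collision (a , b , ((a∈R , b∈R) , tails) , head≢)
  in  agree-inside (decidable-stable (head (f a) ≟ᵇ head (f b)) heads) tails
... | yes (r₁ , r₂ , ((r₁∈R , r₂∈R) , same-tail) , head≢)
  with redundant-coordinate (tail ∘ f) (R - r₂) C (<-≤-trans (x∈p⇒∣p-x∣<∣p∣ r₂∈R) ∣R∣≤∣C∣)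
... | i , i∈C , redundant = suc i , there i∈C , λ {a} {b} a∈R b∈R agr →
  let a′ , a′∈ , aa′ = representative a∈R
      b′ , b′∈ , bb′ = representative b∈R
      a′b′ = agree-trans (agree-mono (p─q⊆p C _) (agree-sym aa′))
                         (agree-trans (agree-tail agr) (agree-mono (p─q⊆p C _) bb′))
  in  agree-inside (agr zero here)
                   (agree-trans aa′ (agree-trans (redundant a′∈ b′∈ a′b′) (agree-sym bb′)))
  where
  r₁≢r₂ : r₁ ≢ r₂
  r₁≢r₂ refl = head≢ refl

  representative : ∀ {a} → a ∈ R → ∃ λ a′ → a′ ∈ R - r₂ × AgreeOn C (tail (f a)) (tail (f a′))
  representative {a} a∈R with a ≟ r₂
  ... | yes refl = r₁ , x∈p∧x≢y⇒x∈p-y r₁∈R r₁≢r₂ , agree-sym same-tail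
  ... | no  a≢r₂ = a , x∈p∧x≢y⇒x∈p-y a∈R a≢r₂ , λ _ _ → refl

bondy : ∀ {m n} (f : Fin m → Fin n → Bool) (R : Subset m) (C : Subset n) →
        Separates f C R → ∣ R ∣ < ∣ C ∣ → ∃ λ i → i ∈ C × Separates f (C - i) R
bondy f R C sep ∣R∣<∣C∣ with redundant-coordinate f R C ∣R∣<∣C∣
... | i , i∈C , redundant = i , i∈C , λ a∈R b∈R → sep a∈R b∈R ∘ redundant a∈R b∈R

dominates? : ∀ {n} (G : Adj n) S x → Dec (x ∉ S → ∃ λ z → z ∈ S × G x z ≡ true)
dominates? G S x = ¬? (x ∈? S) →-dec any? (λ z → z ∈? S ×-dec G x z ≟ᵇ true)

dominating? : ∀ {n} (G : Adj n) S → Dec (Dominating G S)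
dominating? G S = all? (dominates? G S)

module _ {n : ℕ} (G : Adj n) where

  complement-≢ : ∀ {x z} → x ≢ z → complement G x z ≡ not (G x z)
  complement-≢ {x} {z} x≢z with x ≟ z
  ... | yes x≡z = ⊥-elim (x≢z x≡z)
  ... | no  _   = refl

  complement-adjacent : ∀ {x z} → x ≢ z → G x z ≡ false → complement G x z ≡ true
  complement-adjacent x≢z Gxz≡false = trans (complement-≢ x≢z) (cong not Gxz≡false)

  stable⇒complement-adjacent : ∀ {A x z} → Stable G A → x ∈ A → z ∈ A → x ≢ z →
                               complement G x z ≡ true
  stable⇒complement-adjacent stable x∈A z∈A x≢z =
    complement-adjacent x≢z (stable _ _ x∈A z∈A)

  agree-complement : ∀ {D : Subset n} {x y} → x ∉ D → y ∉ D →
                     AgreeOn D (complement G x) (complement G y) → AgreeOn D (G x) (G y)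
  agree-complement x∉D y∉D agr z z∈D = not-injective (begin
    not (G _ z)          ≡⟨ sym (complement-≢ (∉∈⇒≢ x∉D z∈D)) ⟩
    complement G _ z     ≡⟨ agr z z∈D ⟩
    complement G _ z     ≡⟨ complement-≢ (∉∈⇒≢ y∉D z∈D) ⟩
    not (G _ z)          ∎)
    where open ≡-Reasoning

  complement-distinguishing : ∀ {S} → Distinguishing G S → Distinguishing (complement G) S
  complement-distinguishing dist x y x∉S y∉S x≢y = dist x y x∉S y∉S x≢y ∘ agree-complement x∉S y∉S

  complement-LD : ∀ {S} → IsLD G S → Dominating (complement G) S → IsLD (complement G) S
  complement-LD (dist , _) dom = complement-distinguishing dist , dom

  distinguishing⇒separates : ∀ {S A : Subset n} → Distinguishing G S → (∀ {x} → x ∈ A → x ∉ S) →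
                             Separates G S A
  distinguishing⇒separates dist A∩S=∅ {a} {b} a∈A b∈A agr with a ≟ b
  ... | yes a≡b = a≡b
  ... | no  a≢b = ⊥-elim (dist a b (A∩S=∅ a∈A) (A∩S=∅ b∈A) a≢b agr)

  LD⇒∣∁S∣<2^∣S∣ : ∀ {S} → IsLD G S → ∣ ∁ S ∣ < 2 ^ ∣ S ∣
  LD⇒∣∁S∣<2^∣S∣ {S} (dist , dom) =
    separated-nonzero⇒∣W∣<2^∣C∣ G S (∁ S) (distinguishing⇒separates dist x∈∁p⇒x∉p)
                           (λ {a} a∈∁S → dom a (x∈∁p⇒x∉p a∈∁S))

  LD-inside⇒∣∁A∣<2^∣A∣ : ∀ {S A} → IsLD G S → S ⊆ A → ∣ ∁ A ∣ < 2 ^ ∣ A ∣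
  LD-inside⇒∣∁A∣<2^∣A∣ {S} {A} ld S⊆A = begin-strict
    ∣ ∁ A ∣    ≤⟨ p⊆q⇒∣p∣≤∣q∣ (λ x∈∁A → x∉p⇒x∈∁p (x∈∁p⇒x∉p x∈∁A ∘ S⊆A)) ⟩
    ∣ ∁ S ∣    <⟨ LD⇒∣∁S∣<2^∣S∣ ld ⟩
    2 ^ ∣ S ∣  ≤⟨ ^-monoʳ-≤ 2 (p⊆q⇒∣p∣≤∣q∣ S⊆A) ⟩
    2 ^ ∣ A ∣  ∎
    where open ≤-Reasoning

  dominating-stable-⊇ : ∀ {S A} → Dominating G S → S ⊆ A → Stable G A → A ⊆ S
  dominating-stable-⊇ {S} dom S⊆A stable {x} x∈A with x ∈? S
  ... | yes x∈S = x∈S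
  ... | no  x∉S with dom x x∉S
  ... | z , z∈S , Gxz≡true with trans (sym Gxz≡true) (stable x z x∈A (S⊆A z∈S))
  ... | ()

  ¬complement-dominating⇒universal : ∀ {S} → ¬ Dominating (complement G) S →
                                     ∃ λ u → u ∉ S × (∀ z → z ∈ S → G u z ≡ true)
  ¬complement-dominating⇒universal {S} ¬dom
    with ¬∀⟶∃¬ n _ (dominates? (complement G) S) ¬dom
  ... | u , ¬u-dominated = u , u∉S , universal
    where
    u∉S : u ∉ S
    u∉S u∈S = ¬u-dominated (λ u∉S → ⊥-elim (u∉S u∈S))

    universal : ∀ z → z ∈ S → G u z ≡ true
    universal z z∈S with G u z ≟ᵇ true
    ... | yes Guz≡true = Guz≡true
    ... | no  Guz≢true = ⊥-elim (¬u-dominated λ _ →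
      z , z∈S , complement-adjacent (∉∈⇒≢ u∉S z∈S) (¬-not Guz≢true))

meets-both-sides⇒complement-λ≤ : ∀ {n} {G : Adj n} {U S : Subset n} →
  Stable G U → Stable G (∁ U) → IsLD G S → Nonempty (S ∩ U) → Nonempty (S ∩ ∁ U) →
  LambdaAtMost (complement G) ∣ S ∣
meets-both-sides⇒complement-λ≤ {G = G} {U} {S} stable-U stable-W ld S∩U≠∅ S∩W≠∅ =
  S , complement-LD G ld dom , ≤-refl
  where
  non-neighbour : ∀ {A x} → Stable G A → x ∉ S → x ∈ A → Nonempty (S ∩ A) →
                  ∃ λ z → z ∈ S × complement G x z ≡ true
  non-neighbour {A} stable x∉S x∈A (z , z∈S∩A) =
    let z∈S , z∈A = x∈p∩q⁻ S A z∈S∩A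
    in  z , z∈S , stable⇒complement-adjacent G stable x∈A z∈A (∉∈⇒≢ x∉S z∈S)

  dom : Dominating (complement G) S
  dom x x∉S with x ∈? U
  ... | yes x∈U = non-neighbour stable-U x∉S x∈U S∩U≠∅
  ... | no  x∉U = non-neighbour stable-W x∉S (x∉p⇒x∈∁p x∉U) S∩W≠∅

universal-vertex-swap : ∀ {n} {G : Adj n} {U : Subset n} {u} →
  IsSimple G → Stable G U → Stable G (∁ U) → ∣ U ∣ < ∣ ∁ U ∣ → Distinguishing G (∁ U) →
  u ∈ U → (∀ z → z ∈ ∁ U → G u z ≡ true) → LambdaAtMost (complement G) ∣ ∁ U ∣
universal-vertex-swap {n} {G} {U} {u} (symmetric , _) stable-U stable-W ∣U∣<∣W∣ dist u∈U universal
  with bondy G U (∁ U) (distinguishing⇒separates G dist x∈p⇒x∉∁p) ∣U∣<∣W∣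
... | w , w∈W , separates = T , (dist-T , dom-T) , ∣T∣≤∣W∣
  where
  W T : Subset n
  W = ∁ U
  T = ⁅ u ⁆ ∪ (W - w)

  u∈T : u ∈ T
  u∈T = x∈p∪q⁺ (inj₁ (x∈⁅x⁆ u))

  W-w⊆T : W - w ⊆ T
  W-w⊆T = x∈p∪q⁺ ∘ inj₂

  ∣T∣≤∣W∣ : ∣ T ∣ ≤ ∣ W ∣
  ∣T∣≤∣W∣ = begin
    ∣ T ∣                  ≤⟨ ∣p∪q∣≤∣p∣+∣q∣ ⁅ u ⁆ (W - w) ⟩
    ∣ ⁅ u ⁆ ∣ + ∣ W - w ∣  ≡⟨ cong (_+ ∣ W - w ∣) (∣⁅x⁆∣≡1 u) ⟩
    suc ∣ W - w ∣          ≤⟨ x∈p⇒∣p-x∣<∣p∣ w∈W ⟩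
    ∣ W ∣                  ∎
    where open ≤-Reasoning

  W-w-nonempty : Nonempty (W - w)
  W-w-nonempty with nonempty? (W - w)
  ... | yes W-w≠∅ = W-w≠∅
  ... | no  W-w=∅ = ⊥-elim (<-irrefl refl (begin-strict
    1              <⟨ s≤s (0<∣p∣ u∈U) ⟩
    suc ∣ U ∣      ≤⟨ ∣U∣<∣W∣ ⟩
    ∣ W ∣          ≤⟨ ∣p∣≤1+∣p-x∣ W w ⟩
    suc ∣ W - w ∣  ≡⟨ cong suc (trans (cong ∣_∣ (Empty-unique W-w=∅)) (∣⊥∣≡0 n)) ⟩
    1              ∎))
    where open ≤-Reasoning

  outside-T∩W : ∀ {x} → x ∉ T → x ∈ W → x ≡ w
  outside-T∩W {x} x∉T x∈W with x ≟ w
  ... | yes x≡w = x≡w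
  ... | no  x≢w = ⊥-elim (x∉T (W-w⊆T (x∈p∧x≢y⇒x∈p-y x∈W x≢w)))

  dom-T : Dominating (complement G) T
  dom-T x x∉T with x ∈? U
  ... | yes x∈U = u , u∈T , stable⇒complement-adjacent G stable-U x∈U u∈U (∉∈⇒≢ x∉T u∈T)
  ... | no  x∉U = let z , z∈W-w = W-w-nonempty; z∈T = W-w⊆T z∈W-w in
    z , z∈T , stable⇒complement-adjacent G stable-W (x∉p⇒x∈∁p x∉U) (p─q⊆p W ⁅ w ⁆ z∈W-w)
                                         (∉∈⇒≢ x∉T z∈T)

  W-non-adjacent-to-u : ∀ {x} → x ∈ W → complement G x u ≡ false
  W-non-adjacent-to-u {x} x∈W =
    trans (complement-≢ G (∉∈⇒≢ (x∈∁p⇒x∉p x∈W) u∈U))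
          (cong not (trans (symmetric x u) (universal x x∈W)))

  u-separates-sides : ∀ {x y} → x ∈ W → y ∉ T → y ∈ U → complement G x u ≢ complement G y u
  u-separates-sides x∈W y∉T y∈U eq
    with trans (sym (W-non-adjacent-to-u x∈W))
               (trans eq (stable⇒complement-adjacent G stable-U y∈U u∈U (∉∈⇒≢ y∉T u∈T)))
  ... | ()

  dist-T : Distinguishing (complement G) T
  dist-T x y x∉T y∉T x≢y agr with x ∈? U | y ∈? U
  ... | yes x∈U | yes y∈U = x≢y (separates x∈U y∈U
    (agree-complement G (x∉T ∘ W-w⊆T) (y∉T ∘ W-w⊆T) (agree-mono {C = T} W-w⊆T agr)))
  ... | yes x∈U | no  y∉U = u-separates-sides (x∉p⇒x∈∁p y∉U) x∉T x∈U (sym (agr u u∈T))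
  ... | no  x∉U | yes y∈U = u-separates-sides (x∉p⇒x∈∁p x∉U) y∉T y∈U (agr u u∈T)
  ... | no  x∉U | no  y∉U =
    x≢y (trans (outside-T∩W x∉T (x∉p⇒x∈∁p x∉U)) (sym (outside-T∩W y∉T (x∉p⇒x∈∁p y∉U))))

LD-side⇒complement-λ≤ : ∀ {n} {G : Adj n} {U : Subset n} →
  IsSimple G → Stable G U → Stable G (∁ U) → ∣ U ∣ < ∣ ∁ U ∣ → IsLD G (∁ U) →
  LambdaAtMost (complement G) ∣ ∁ U ∣
LD-side⇒complement-λ≤ {G = G} {U} simple stable-U stable-W ∣U∣<∣W∣ ld
  with dominating? (complement G) (∁ U)
... | yes dom  = ∁ U , complement-LD G ld dom , ≤-refl
... | no  ¬dom with ¬complement-dominating⇒universal G ¬dom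
... | u , u∉W , universal =
  universal-vertex-swap simple stable-U stable-W ∣U∣<∣W∣ (proj₁ ld) (x∉∁p⇒x∈p u∉W) universal

lemma13 : ∀ (n : ℕ) (G : Adj n) (U S : Subset n) →
    IsSimple G → Connected G → 4 ≤ n →
    Stable G U → Stable G (∁ U) → ∣ U ∣ ≤ ∣ ∁ U ∣ →
    IsMinLD G S →
    ((Nonempty (S ∩ U) × Nonempty (S ∩ ∁ U))
      ⊎ (∣ U ∣ < ∣ ∁ U ∣ × S ≡ ∁ U)
      ⊎ (2 ^ ∣ U ∣ ≤ ∣ ∁ U ∣)) →
    LambdaAtMost (complement G) ∣ S ∣
lemma13 _ G U S simple _ _ stable-U stable-W _ (ld , _) (inj₁ (S∩U≠∅ , S∩W≠∅)) =
  meets-both-sides⇒complement-λ≤ stable-U stable-W ld S∩U≠∅ S∩W≠∅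
lemma13 _ G U S simple _ _ stable-U stable-W _ (ld , _) (inj₂ (inj₁ (∣U∣<∣W∣ , refl))) =
  LD-side⇒complement-λ≤ simple stable-U stable-W ∣U∣<∣W∣ ld
lemma13 _ G U S simple _ _ stable-U stable-W _ (ld , _) (inj₂ (inj₂ 2^∣U∣≤∣W∣))
  with nonempty? (S ∩ U) | nonempty? (S ∩ ∁ U)
... | yes S∩U≠∅ | yes S∩W≠∅ = meets-both-sides⇒complement-λ≤ stable-U stable-W ld S∩U≠∅ S∩W≠∅
... | no  S∩U=∅ | _         =
  subst (LambdaAtMost (complement G) ∘ ∣_∣) (sym S≡W)
        (LD-side⇒complement-λ≤ simple stable-U stable-W (<-≤-trans (n<2^n ∣ U ∣) 2^∣U∣≤∣W∣)
                               (subst (IsLD G) S≡W ld))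
  where
  S⊆W : S ⊆ ∁ U
  S⊆W = disjoint⇒⊆∁ S∩U=∅
  S≡W : S ≡ ∁ U
  S≡W = ⊆-antisym S⊆W (dominating-stable-⊇ G (proj₂ ld) S⊆W stable-W)
... | yes _     | no  S∩W=∅ = ⊥-elim (<⇒≱ (LD-inside⇒∣∁A∣<2^∣A∣ G ld S⊆U) 2^∣U∣≤∣W∣)
  where
  S⊆U : S ⊆ U
  S⊆U = x∉∁p⇒x∈p ∘ x∈∁p⇒x∉p ∘ disjoint⇒⊆∁ S∩W=∅
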